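{- Let $c, d, r$ be natural numbers with $c \neq 0$ and $r > 1$, and let $A = \{a_k\}_{k=1}^\infty$ with $a_k = c r^k + d$ for all $k \ge 1$. Then $A$ contains no MSTD subsets.
   Context: For a finite set $S$ of integers, $S+S = \{x+y : x,y \in S\}$ and $S-S = \{x-y : x,y\in S\}$; $S$ is an MSTD (More Sums Than Differences) set if $|S+S| > |S-S|$. An MSTD subset of $A$ means a finite subset of $\{a_k : k\ge 1\}$ which is an MSTD set. Natural numbers are the nonnegative integers. -}

module Defs where

open import Data.Nat using (ℕ; _+_; _*_; _^_; _≤_; _<_)
open import Data.Integer as ℤ using (ℤ; +_)
open import Data.List using (List; length; cartesianProductWith; deduplicate)
open import Data.Product using (∃; _×_)
open import Relation.Binary.PropositionalEquality using (_≡_)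

-- A finite set of integers is represented by a list; its cardinality is the
-- number of distinct entries.
card : List ℤ → ℕ
card xs = length (deduplicate ℤ._≟_ xs)

sumset : List ℤ → List ℤ
sumset S = cartesianProductWith ℤ._+_ S S

diffset : List ℤ → List ℤ
diffset S = cartesianProductWith ℤ._-_ S S

IsMSTD : List ℤ → Set
IsMSTD S = card (diffset S) < card (sumset S)

seqA : ℕ → ℕ → ℕ → ℕ → ℕ
seqA c d r k = c * r ^ k + d

InA : ℕ → ℕ → ℕ → ℤ → Set
InA c d r x = ∃ λ k → (1 ≤ k) × (x ≡ + seqA c d r k)

-- The set A is a Sidon set: since c ≠ 0, a sum a_i + a_j determines r^i + r^j, and for r ≥ 2
-- the equation r^i + r^j = r^a + r^b forces {i, j} = {a, b} (cancel common factors r; once an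
-- exponent is zero, compare residues mod r). In a Sidon set with n elements the n(n-1)/2
-- two-element subsets {x, y} give n(n-1) distinct nonzero differences x - y, y - x, while
-- S + S consists of the n doubles 2x and one sum x + y per subset, so
-- |S+S| ≤ n + n(n-1)/2 ≤ 1 + n(n-1) ≤ |S-S|.
module Submission where

open import Defs
open import Data.Nat using (ℕ; _<_)
open import Data.Integer using (ℤ)
open import Data.List using (List)
open import Data.List.Relation.Unary.All using (All)
open import Relation.Binary.PropositionalEquality using (_≢_)
open import Relation.Nullary using (¬_)

open import Level using (Level)
open import Data.Nat using (zero; suc; _+_; _*_; _^_; _≤_; z≤n; s≤s; z<s; NonZero; >-nonZero; ≢-nonZero)
import Data.Nat.Properties as ℕ
open import Data.Nat.Divisibility using (_∣_; m∣m*n; ∣m+n∣m⇒∣n; ∣1⇒≡1)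
import Data.Nat.Tactic.RingSolver as ℕSolver
import Data.Integer as ℤ
import Data.Integer.Properties as ℤ
open import Data.Integer.Tactic.RingSolver using (solve-∀)
open import Data.List using ([]; _∷_; length; map; _++_; deduplicate)
open import Data.List.Properties using (length-++; length-map; length-removeAt′)
open import Data.List.Relation.Unary.Any using (here; there; _─_)
import Data.List.Relation.Unary.All as All
import Data.List.Relation.Unary.All.Properties as All
open import Data.List.Relation.Unary.Unique.Propositional using (Unique; []; _∷_)
import Data.List.Relation.Unary.Unique.Propositional.Properties as Unique
open import Data.List.Relation.Unary.Unique.DecPropositional.Properties using (deduplicate-!)
open import Data.List.Relation.Binary.Subset.Propositional using (_⊆_)
open import Data.List.Relation.Binary.Disjoint.Propositional using (Disjoint)
open import Data.List.Membership.Propositional using (_∈_; _∉_)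
open import Data.List.Membership.Propositional.Properties
  using (∈-map⁺; ∈-map⁻; ∈-++⁺ˡ; ∈-++⁺ʳ; ∈-++⁻; ∈-cartesianProductWith⁺; ∈-cartesianProductWith⁻;
         ∈-deduplicate⁺; ∈-deduplicate⁻)
open import Data.Product using (_×_; _,_; proj₁; proj₂; swap; uncurry)
open import Data.Product.Properties using (,-injectiveʳ)
open import Data.Sum using (_⊎_; inj₁; inj₂)
open import Function using (_∘_)
open import Relation.Nullary using (yes; no; contradiction)
open import Relation.Binary.Definitions using (tri<; tri≈; tri>)
open import Relation.Binary.PropositionalEquality using (_≡_; refl; sym; trans; cong; cong₂; subst; module ≡-Reasoning)

private
  variable
    a : Level
    A : Set a

∈-─⁺ : ∀ {x y} {ys : List A} (x∈ys : x ∈ ys) → y ∈ ys → y ≢ x → y ∈ (ys ─ x∈ys)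
∈-─⁺ (here refl) (here refl) y≢x = contradiction refl y≢x
∈-─⁺ (here refl) (there y∈ys) _ = y∈ys
∈-─⁺ (there x∈ys) (here refl) _ = here refl
∈-─⁺ (there x∈ys) (there y∈ys) y≢x = there (∈-─⁺ x∈ys y∈ys y≢x)

Unique-⊆⇒length≤ : {xs ys : List A} → Unique xs → xs ⊆ ys → length xs ≤ length ys
Unique-⊆⇒length≤ [] _ = z≤n
Unique-⊆⇒length≤ {xs = x ∷ xs} {ys} (x∉xs ∷ !xs) xs⊆ys =
  subst (suc (length xs) ≤_) (sym (length-removeAt′ ys _))
    (s≤s (Unique-⊆⇒length≤ !xs λ y∈xs →
      ∈-─⁺ x∈ys (xs⊆ys (there y∈xs)) (λ y≡x → All.lookup x∉xs y∈xs (sym y≡x))))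
  where
  x∈ys : x ∈ ys
  x∈ys = xs⊆ys (here refl)

Unique-map⁺-∈ : ∀ {b} {B : Set b} {f : A → B} {xs : List A} →
  (∀ {x y} → x ∈ xs → y ∈ xs → f x ≡ f y → x ≡ y) → Unique xs → Unique (map f xs)
Unique-map⁺-∈ f-inj [] = []
Unique-map⁺-∈ {f = f} f-inj (x∉xs ∷ !xs) =
  All.map⁺ (All.tabulate λ y∈xs fx≡fy → All.lookup x∉xs y∈xs (f-inj (here refl) (there y∈xs) fx≡fy))
  ∷ Unique-map⁺-∈ (λ x∈xs y∈xs → f-inj (there x∈xs) (there y∈xs)) !xs

pairs : List A → List (A × A)
pairs [] = []
pairs (x ∷ xs) = map (x ,_) xs ++ pairs xs

length≤1+length-pairs : (xs : List A) → length xs ≤ suc (length (pairs xs))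
length≤1+length-pairs [] = z≤n
length≤1+length-pairs (x ∷ xs) = s≤s (begin
  length xs                                  ≡⟨ sym (length-map (x ,_) xs) ⟩
  length (map (x ,_) xs)                     ≤⟨ ℕ.m≤m+n _ _ ⟩
  length (map (x ,_) xs) + length (pairs xs) ≡⟨ sym (length-++ (map (x ,_) xs)) ⟩
  length (pairs (x ∷ xs))                    ∎)
  where open ℕ.≤-Reasoning

∈-pairs-∷⁻ : ∀ x xs {u v : A} → (u , v) ∈ pairs (x ∷ xs) → (u ≡ x × v ∈ xs) ⊎ (u , v) ∈ pairs xs
∈-pairs-∷⁻ x xs uv∈ with ∈-++⁻ (map (x ,_) xs) uv∈
... | inj₂ uv∈pairs = inj₂ uv∈pairs
... | inj₁ uv∈map with ∈-map⁻ (x ,_) uv∈map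
...   | v , v∈xs , refl = inj₁ (refl , v∈xs)

∈-pairs⁻ : ∀ {u v} {xs : List A} → (u , v) ∈ pairs xs → u ∈ xs × v ∈ xs
∈-pairs⁻ {xs = x ∷ xs} uv∈ with ∈-pairs-∷⁻ x xs uv∈
... | inj₁ (refl , v∈xs) = here refl , there v∈xs
... | inj₂ uv∈pairs = let u∈xs , v∈xs = ∈-pairs⁻ uv∈pairs in there u∈xs , there v∈xs

∈-pairs⁺ : ∀ {u v} {xs : List A} → u ∈ xs → v ∈ xs → u ≢ v → (u , v) ∈ pairs xs ⊎ (v , u) ∈ pairs xs
∈-pairs⁺ (here refl) (here refl) u≢v = contradiction refl u≢v
∈-pairs⁺ {xs = x ∷ xs} (here refl) (there v∈xs) _ = inj₁ (∈-++⁺ˡ (∈-map⁺ (x ,_) v∈xs))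
∈-pairs⁺ {xs = x ∷ xs} (there u∈xs) (here refl) _ = inj₂ (∈-++⁺ˡ (∈-map⁺ (x ,_) u∈xs))
∈-pairs⁺ {xs = x ∷ xs} (there u∈xs) (there v∈xs) u≢v with ∈-pairs⁺ u∈xs v∈xs u≢v
... | inj₁ uv∈ = inj₁ (∈-++⁺ʳ (map (x ,_) xs) uv∈)
... | inj₂ vu∈ = inj₂ (∈-++⁺ʳ (map (x ,_) xs) vu∈)

∈-pairs-∷⁻ʳ : ∀ x xs {u v : A} → (u , v) ∈ pairs (x ∷ xs) → v ∈ xs
∈-pairs-∷⁻ʳ x xs uv∈ with ∈-pairs-∷⁻ x xs uv∈
... | inj₁ (_ , v∈xs) = v∈xs
... | inj₂ uv∈pairs = proj₂ (∈-pairs⁻ uv∈pairs)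

pairs-asym : ∀ {u v} {xs : List A} → Unique xs → (u , v) ∈ pairs xs → (v , u) ∉ pairs xs
pairs-asym {xs = x ∷ xs} !xxs@(_ ∷ !xs) uv∈ vu∈ with ∈-pairs-∷⁻ x xs uv∈ | ∈-pairs-∷⁻ x xs vu∈
... | inj₁ (refl , _) | _ = Unique.Unique[x∷xs]⇒x∉xs !xxs (∈-pairs-∷⁻ʳ x xs vu∈)
... | _ | inj₁ (refl , _) = Unique.Unique[x∷xs]⇒x∉xs !xxs (∈-pairs-∷⁻ʳ x xs uv∈)
... | inj₂ uv∈pairs | inj₂ vu∈pairs = pairs-asym !xs uv∈pairs vu∈pairs

pairs-irrefl : ∀ {u v} {xs : List A} → Unique xs → (u , v) ∈ pairs xs → u ≢ v
pairs-irrefl !xs uv∈ refl = pairs-asym !xs uv∈ uv∈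

pairs-Unique : {xs : List A} → Unique xs → Unique (pairs xs)
pairs-Unique [] = []
pairs-Unique {xs = x ∷ xs} !xxs@(_ ∷ !xs) =
  Unique.++⁺ (Unique.map⁺ ,-injectiveʳ !xs) (pairs-Unique !xs) head∉pairs
  where
  head∉pairs : Disjoint (map (x ,_) xs) (pairs xs)
  head∉pairs (p∈map , p∈pairs) with ∈-map⁻ (x ,_) p∈map
  ... | _ , _ , refl = Unique.Unique[x∷xs]⇒x∉xs !xxs (proj₁ (∈-pairs⁻ p∈pairs))

offDiagonal : List A → List (A × A)
offDiagonal xs = pairs xs ++ map swap (pairs xs)

length-offDiagonal : (xs : List A) → length (offDiagonal xs) ≡ length (pairs xs) + length (pairs xs)
length-offDiagonal xs = trans (length-++ (pairs xs)) (cong (length (pairs xs) +_) (length-map swap (pairs xs)))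

∈-offDiagonal⁻ : ∀ {u v} {xs : List A} → (u , v) ∈ offDiagonal xs → u ∈ xs × v ∈ xs
∈-offDiagonal⁻ {xs = xs} uv∈ with ∈-++⁻ (pairs xs) uv∈
... | inj₁ uv∈pairs = ∈-pairs⁻ uv∈pairs
... | inj₂ uv∈swapped with ∈-map⁻ swap uv∈swapped
...   | _ , vu∈pairs , refl = swap (∈-pairs⁻ vu∈pairs)

offDiagonal-irrefl : ∀ {u v} {xs : List A} → Unique xs → (u , v) ∈ offDiagonal xs → u ≢ v
offDiagonal-irrefl {xs = xs} !xs uv∈ with ∈-++⁻ (pairs xs) uv∈
... | inj₁ uv∈pairs = pairs-irrefl !xs uv∈pairs
... | inj₂ uv∈swapped with ∈-map⁻ swap uv∈swapped
...   | _ , vu∈pairs , refl = pairs-irrefl !xs vu∈pairs ∘ sym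

offDiagonal-Unique : {xs : List A} → Unique xs → Unique (offDiagonal xs)
offDiagonal-Unique {xs = xs} !xs = Unique.++⁺ !pairs (Unique.map⁺ (cong swap) !pairs) pairs∩swapped≡∅
  where
  !pairs : Unique (pairs xs)
  !pairs = pairs-Unique !xs
  pairs∩swapped≡∅ : Disjoint (pairs xs) (map swap (pairs xs))
  pairs∩swapped≡∅ (p∈pairs , p∈swapped) with ∈-map⁻ swap p∈swapped
  ... | _ , q∈pairs , refl = pairs-asym !xs q∈pairs p∈pairs

SamePair : {A : Set a} → A → A → A → A → Set a
SamePair x y u v = (x ≡ u × y ≡ v) ⊎ (x ≡ v × y ≡ u)

SamePair-swapˡ : ∀ {x y u v : A} → SamePair x y u v → SamePair y x u v
SamePair-swapˡ (inj₁ (x≡u , y≡v)) = inj₂ (y≡v , x≡u)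
SamePair-swapˡ (inj₂ (x≡v , y≡u)) = inj₁ (y≡u , x≡v)

SamePair-map : ∀ {b} {B : Set b} (f : A → B) {x y u v} → SamePair x y u v → SamePair (f x) (f y) (f u) (f v)
SamePair-map f (inj₁ (x≡u , y≡v)) = inj₁ (cong f x≡u , cong f y≡v)
SamePair-map f (inj₂ (x≡v , y≡u)) = inj₂ (cong f x≡v , cong f y≡u)

Sidon : (ℤ → Set a) → Set a
Sidon P = ∀ {x y u v} → P x → P y → P u → P v → x ℤ.+ y ≡ u ℤ.+ v → SamePair x y u v

pairSums : List ℤ → List ℤ
pairSums xs = map (λ x → x ℤ.+ x) xs ++ map (uncurry ℤ._+_) (pairs xs)

differences : List ℤ → List ℤ
differences xs = ℤ.0ℤ ∷ map (uncurry ℤ._-_) (offDiagonal xs)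

length-pairSums≤length-differences : ∀ xs → length (pairSums xs) ≤ length (differences xs)
length-pairSums≤length-differences xs = begin
  length (pairSums xs)                          ≡⟨ length-++ (map (λ x → x ℤ.+ x) xs) ⟩
  length (map _ xs) + length (map _ (pairs xs)) ≡⟨ cong₂ _+_ (length-map _ xs) (length-map _ (pairs xs)) ⟩
  length xs + p                                 ≤⟨ ℕ.+-monoˡ-≤ p (length≤1+length-pairs xs) ⟩
  suc (p + p)                                   ≡⟨ cong suc (sym (length-offDiagonal xs)) ⟩
  suc (length (offDiagonal xs))                 ≡⟨ cong suc (sym (length-map _ (offDiagonal xs))) ⟩
  length (differences xs)                       ∎
  where
  open ℕ.≤-Reasoning
  p : ℕ
  p = length (pairs xs)

sumset⊆pairSums : {xs ys : List ℤ} → xs ⊆ ys → sumset xs ⊆ pairSums ys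
sumset⊆pairSums {xs} {ys} xs⊆ys s∈ with ∈-cartesianProductWith⁻ ℤ._+_ xs xs s∈
... | u , v , u∈xs , v∈xs , refl with u ℤ.≟ v
...   | yes refl = ∈-++⁺ˡ (∈-map⁺ (λ x → x ℤ.+ x) (xs⊆ys u∈xs))
...   | no u≢v with ∈-pairs⁺ (xs⊆ys u∈xs) (xs⊆ys v∈xs) u≢v
...     | inj₁ uv∈ = ∈-++⁺ʳ (map _ ys) (∈-map⁺ (uncurry ℤ._+_) uv∈)
...     | inj₂ vu∈ = ∈-++⁺ʳ (map _ ys) (subst (_∈ _) (ℤ.+-comm v u) (∈-map⁺ (uncurry ℤ._+_) vu∈))

differences⊆diffset : ∀ {x} {xs ys : List ℤ} → x ∈ ys → xs ⊆ ys → differences xs ⊆ diffset ys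
differences⊆diffset {x} x∈ys xs⊆ys (here refl) =
  subst (_∈ _) (ℤ.+-inverseʳ x) (∈-cartesianProductWith⁺ ℤ._-_ x∈ys x∈ys)
differences⊆diffset _ xs⊆ys (there d∈) with ∈-map⁻ (uncurry ℤ._-_) d∈
... | _ , uv∈ , refl = let u∈xs , v∈xs = ∈-offDiagonal⁻ uv∈ in
  ∈-cartesianProductWith⁺ ℤ._-_ (xs⊆ys u∈xs) (xs⊆ys v∈xs)

-≡-⇒+≡+ : ∀ {x y u v} → x ℤ.- y ≡ u ℤ.- v → x ℤ.+ v ≡ u ℤ.+ y
-≡-⇒+≡+ {x} {y} {u} {v} eq = begin
  x ℤ.+ v                     ≡⟨ regroup x y v ⟩
  (x ℤ.- y) ℤ.+ (y ℤ.+ v)     ≡⟨ cong (ℤ._+ (y ℤ.+ v)) eq ⟩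
  (u ℤ.- v) ℤ.+ (y ℤ.+ v)     ≡⟨ ungroup u v y ⟩
  u ℤ.+ y                     ∎
  where
  open ≡-Reasoning
  regroup : ∀ x y v → x ℤ.+ v ≡ (x ℤ.- y) ℤ.+ (y ℤ.+ v)
  regroup = solve-∀
  ungroup : ∀ u v y → (u ℤ.- v) ℤ.+ (y ℤ.+ v) ≡ u ℤ.+ y
  ungroup = solve-∀

module _ {P : ℤ → Set a} (sidon : Sidon P) where

  Sidon-difference-injective : ∀ {x y u v} → P x → P y → P u → P v → x ≢ y →
    x ℤ.- y ≡ u ℤ.- v → x ≡ u × y ≡ v
  Sidon-difference-injective {x} {y} {u} {v} px py pu pv x≢y eq
    with sidon px pv pu py (-≡-⇒+≡+ {x} {y} {u} {v} eq)
  ... | inj₁ (x≡u , v≡y) = x≡u , sym v≡y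
  ... | inj₂ (x≡y , _) = contradiction x≡y x≢y

  differences-Unique : {xs : List ℤ} → Unique xs → All P xs → Unique (differences xs)
  differences-Unique {xs} !xs pxs =
    All.map⁺ (All.tabulate 0≢difference) ∷ Unique-map⁺-∈ difference-injective (offDiagonal-Unique !xs)
    where
    0≢difference : ∀ {p} → p ∈ offDiagonal xs → ℤ.0ℤ ≢ uncurry ℤ._-_ p
    0≢difference {u , v} uv∈ 0≡u-v = offDiagonal-irrefl !xs uv∈ (ℤ.i-j≡0⇒i≡j u v (sym 0≡u-v))
    difference-injective : ∀ {p q} → p ∈ offDiagonal xs → q ∈ offDiagonal xs →
      uncurry ℤ._-_ p ≡ uncurry ℤ._-_ q → p ≡ q
    difference-injective uv∈ u'v'∈ eq =
      let u∈ , v∈ = ∈-offDiagonal⁻ uv∈ ; u'∈ , v'∈ = ∈-offDiagonal⁻ u'v'∈ in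
      uncurry (cong₂ _,_) (Sidon-difference-injective
        (All.lookup pxs u∈) (All.lookup pxs v∈) (All.lookup pxs u'∈) (All.lookup pxs v'∈)
        (offDiagonal-irrefl !xs uv∈) eq)

  Sidon⇒card-sumset≤card-diffset : ∀ S → All P S → card (sumset S) ≤ card (diffset S)
  Sidon⇒card-sumset≤card-diffset [] _ = z≤n
  Sidon⇒card-sumset≤card-diffset S@(_ ∷ _) pS = begin
    card (sumset S)          ≤⟨ Unique-⊆⇒length≤ (deduplicate-! ℤ._≟_ (sumset S))
                                  (sumset⊆pairSums S⊆T ∘ ∈-deduplicate⁻ ℤ._≟_ (sumset S)) ⟩
    length (pairSums T)      ≤⟨ length-pairSums≤length-differences T ⟩
    length (differences T)   ≤⟨ Unique-⊆⇒length≤ (differences-Unique (deduplicate-! ℤ._≟_ S) (All.deduplicate⁺ ℤ._≟_ pS))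
                                  (∈-deduplicate⁺ ℤ._≟_ ∘ differences⊆diffset (here refl) T⊆S) ⟩
    card (diffset S)         ∎
    where
    open ℕ.≤-Reasoning
    T : List ℤ
    T = deduplicate ℤ._≟_ S
    S⊆T : S ⊆ T
    S⊆T = ∈-deduplicate⁺ ℤ._≟_
    T⊆S : T ⊆ S
    T⊆S = ∈-deduplicate⁻ ℤ._≟_ S

module _ {r : ℕ} (1<r : 1 < r) where

  private instance
    r≢0 : NonZero r
    r≢0 = >-nonZero (ℕ.<-trans z<s 1<r)

  ^-injective : ∀ {m n} → r ^ m ≡ r ^ n → m ≡ n
  ^-injective {m} {n} r^m≡r^n with ℕ.<-cmp m n
  ... | tri< m<n _ _ = contradiction r^m≡r^n (ℕ.<⇒≢ (ℕ.^-monoʳ-< r 1<r m<n))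
  ... | tri≈ _ m≡n _ = m≡n
  ... | tri> _ _ n<m = contradiction (sym r^m≡r^n) (ℕ.<⇒≢ (ℕ.^-monoʳ-< r 1<r n<m))

  1<r^1+n : ∀ n → 1 < r ^ suc n
  1<r^1+n n = ℕ.^-monoʳ-< r 1<r {0} {suc n} z<s

  1+r*m≢r*n : ∀ m n → suc (r * m) ≢ r * n
  1+r*m≢r*n m n eq = ℕ.<⇒≢ 1<r (sym (∣1⇒≡1 r∣1))
    where
    r∣1 : r ∣ 1
    r∣1 = ∣m+n∣m⇒∣n (subst (r ∣_) (sym (trans (ℕ.+-comm (r * m) 1) eq)) (m∣m*n n)) (m∣m*n m)

  1+r^j≡r^a+r^b⇒SamePair : ∀ j a b → 1 + r ^ j ≡ r ^ a + r ^ b → SamePair 0 j a b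
  1+r^j≡r^a+r^b⇒SamePair j zero b eq = inj₁ (refl , ^-injective (ℕ.+-cancelˡ-≡ 1 _ _ eq))
  1+r^j≡r^a+r^b⇒SamePair j (suc a) zero eq =
    inj₂ (refl , ^-injective (ℕ.+-cancelˡ-≡ 1 _ _ (trans eq (ℕ.+-comm (r ^ suc a) 1))))
  -- For r = 2 the residue argument cannot exclude this case (2 ∣ 1 + 1), so compare sizes.
  1+r^j≡r^a+r^b⇒SamePair zero (suc a) (suc b) eq =
    contradiction eq (ℕ.<⇒≢ (ℕ.+-mono-< (1<r^1+n a) (1<r^1+n b)))
  1+r^j≡r^a+r^b⇒SamePair (suc j) (suc a) (suc b) eq =
    contradiction (trans eq (sym (ℕ.*-distribˡ-+ r (r ^ a) (r ^ b)))) (1+r*m≢r*n (r ^ j) (r ^ a + r ^ b))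

  ^-sum-injective : ∀ i j a b → r ^ i + r ^ j ≡ r ^ a + r ^ b → SamePair i j a b
  ^-sum-injective zero j a b eq = 1+r^j≡r^a+r^b⇒SamePair j a b eq
  ^-sum-injective (suc i) zero a b eq =
    SamePair-swapˡ (1+r^j≡r^a+r^b⇒SamePair (suc i) a b (trans (ℕ.+-comm 1 (r ^ suc i)) eq))
  ^-sum-injective (suc i) (suc j) zero b eq
    with 1+r^j≡r^a+r^b⇒SamePair b (suc i) (suc j) (sym eq)
  ... | inj₁ (() , _)
  ... | inj₂ (() , _)
  ^-sum-injective (suc i) (suc j) (suc a) zero eq
    with 1+r^j≡r^a+r^b⇒SamePair (suc a) (suc i) (suc j) (trans (ℕ.+-comm 1 (r ^ suc a)) (sym eq))
  ... | inj₁ (() , _)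
  ... | inj₂ (() , _)
  ^-sum-injective (suc i) (suc j) (suc a) (suc b) eq =
    SamePair-map suc (^-sum-injective i j a b (ℕ.*-cancelˡ-≡ _ _ r (begin
      r * (r ^ i + r ^ j)       ≡⟨ ℕ.*-distribˡ-+ r (r ^ i) (r ^ j) ⟩
      r ^ suc i + r ^ suc j     ≡⟨ eq ⟩
      r ^ suc a + r ^ suc b     ≡⟨ sym (ℕ.*-distribˡ-+ r (r ^ a) (r ^ b)) ⟩
      r * (r ^ a + r ^ b)       ∎)))
    where open ≡-Reasoning

InA-Sidon : ∀ {c d r} → c ≢ 0 → 1 < r → Sidon (InA c d r)
InA-Sidon {c} {d} {r} c≢0 1<r (i , _ , refl) (j , _ , refl) (k , _ , refl) (l , _ , refl) eq =
  SamePair-map (λ n → ℤ.+ seqA c d r n) (^-sum-injective 1<r i j k l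
    (ℕ.*-cancelˡ-≡ _ _ c (ℕ.+-cancelʳ-≡ (d + d) _ _ (begin
      c * (r ^ i + r ^ j) + (d + d) ≡⟨ sym (seqA-sum i j) ⟩
      seqA c d r i + seqA c d r j   ≡⟨ ℤ.+-injective eq ⟩
      seqA c d r k + seqA c d r l   ≡⟨ seqA-sum k l ⟩
      c * (r ^ k + r ^ l) + (d + d) ∎))))
  where
  open ≡-Reasoning
  instance
    c≢0′ : NonZero c
    c≢0′ = ≢-nonZero c≢0
  rearrange : ∀ c d x y → c * x + d + (c * y + d) ≡ c * (x + y) + (d + d)
  rearrange = ℕSolver.solve-∀
  seqA-sum : ∀ m n → seqA c d r m + seqA c d r n ≡ c * (r ^ m + r ^ n) + (d + d)
  seqA-sum m n = rearrange c d (r ^ m) (r ^ n)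

corollary2p2 : (c d r : ℕ) → c ≢ 0 → 1 < r →
    (S : List ℤ) → All (InA c d r) S → ¬ IsMSTD S
corollary2p2 c d r c≢0 1<r S S⊆A mstd =
  ℕ.<⇒≱ mstd (Sidon⇒card-sumset≤card-diffset (InA-Sidon c≢0 1<r) S S⊆A)
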